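{- Let $F$ be a forest and let $\tau$ be a 2-switch on $F$ such that $\tau(F)$ is a forest. Then $|\operatorname{rank}(\tau(F))-\operatorname{rank}(F)|=|\operatorname{null}(\tau(F))-\operatorname{null}(F)|\in\{0,2\}$.
   Context: Graphs are finite and simple. A 2-switch on $G$ is specified by four distinct vertices $a,b,c,d$ with $ab,cd\in E(G)$ and $ac,bd\notin E(G)$; it produces $\tau(G)=G-ab-cd+ac+bd$. The rank and nullity of a graph are the rank and nullity of its adjacency matrix. -}

module Defs where

open import Data.Nat using (ℕ; zero; suc; _∸_)
open import Data.Fin using (Fin; zero; suc; inject₁; fromℕ)
open import Data.Fin.Properties using (_≟_)
open import Data.Bool using (Bool; true; false; if_then_else_; _∧_; _∨_)
open import Data.Product using (Σ; _×_; _,_)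
open import Data.Rational using (ℚ; 0ℚ; 1ℚ; _+_; _*_)
open import Relation.Binary.PropositionalEquality using (_≡_)
open import Relation.Nullary using (¬_)
open import Relation.Nullary.Decidable using (⌊_⌋)
open import Function.Definitions using (Injective)

record Graph (n : ℕ) : Set where
  field
    adj    : Fin n → Fin n → Bool
    sym    : ∀ i j → adj i j ≡ adj j i
    irrefl : ∀ i → adj i i ≡ false
open Graph public

record Cycle {n : ℕ} (A : Fin n → Fin n → Bool) : Set where
  field
    k     : ℕ
    v     : Fin (suc (suc (suc k))) → Fin n
    inj   : Injective _≡_ _≡_ v
    step  : ∀ (i : Fin (suc (suc k))) → A (v (inject₁ i)) (v (suc i)) ≡ true
    close : A (v (fromℕ (suc (suc k)))) (v zero) ≡ true

IsForest : {n : ℕ} → (Fin n → Fin n → Bool) → Set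
IsForest A = ¬ Cycle A

record IsTwoSwitch {n : ℕ} (G : Graph n) (a b c d : Fin n) : Set where
  field
    a≢b : ¬ a ≡ b
    a≢c : ¬ a ≡ c
    a≢d : ¬ a ≡ d
    b≢c : ¬ b ≡ c
    b≢d : ¬ b ≡ d
    c≢d : ¬ c ≡ d
    ab∈E : adj G a b ≡ true
    cd∈E : adj G c d ≡ true
    ac∉E : adj G a c ≡ false
    bd∉E : adj G b d ≡ false

samePair : {n : ℕ} → Fin n → Fin n → Fin n → Fin n → Bool
samePair x y u w = (⌊ x ≟ u ⌋ ∧ ⌊ y ≟ w ⌋) ∨ (⌊ x ≟ w ⌋ ∧ ⌊ y ≟ u ⌋)

switchAdj : {n : ℕ} → Graph n → (a b c d : Fin n) → Fin n → Fin n → Bool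
switchAdj G a b c d x y =
  if samePair x y a b ∨ samePair x y c d then false
  else if samePair x y a c ∨ samePair x y b d then true
  else adj G x y

adjMatrix : {n : ℕ} → (Fin n → Fin n → Bool) → Fin n → Fin n → ℚ
adjMatrix A i j = if A i j then 1ℚ else 0ℚ

sumFin : (m : ℕ) → (Fin m → ℚ) → ℚ
sumFin zero    f = 0ℚ
sumFin (suc m) f = f zero + sumFin m (λ j → f (suc j))

LinIndepCols : {n : ℕ} → (Fin n → Fin n → ℚ) → (r : ℕ) → (Fin r → Fin n) → Set
LinIndepCols {n} M r σ =
  ∀ (c : Fin r → ℚ) → (∀ (i : Fin n) → sumFin r (λ j → c j * M i (σ j)) ≡ 0ℚ) →
  ∀ j → c j ≡ 0ℚ

IsRank : {n : ℕ} → (Fin n → Fin n → ℚ) → ℕ → Set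
IsRank {n} M r =
  Σ (Fin r → Fin n) (λ σ → Injective _≡_ _≡_ σ × LinIndepCols M r σ) ×
  (∀ (σ : Fin (suc r) → Fin n) → Injective _≡_ _≡_ σ → ¬ LinIndepCols M (suc r) σ)

nullity : ℕ → ℕ → ℕ
nullity n r = n ∸ r

{-# OPTIONS --safe #-}

-- A 2-switch changes the adjacency matrix by (e_a − e_d)(e_c − e_b)ᵀ + (e_c − e_b)(e_a − e_d)ᵀ,
-- a sum of two rank-one matrices, so the ranks of F and τ(F) differ by at most 2: every column
-- of one matrix lies in the span of a column basis of the other together with two more vectors.
-- The adjacency matrix of a forest has even rank. A forest with an edge has a leaf v, with
-- neighbour u; deleting all edges at u is again a sum of two rank-one changes, while the columns
-- u and v of the original matrix are independent of each other and of any independent columns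
-- of the smaller graph, so the rank drops by exactly 2 and induction on the number of edges
-- applies. Two even numbers at distance at most 2 differ by 0 or 2, and the nullities n − r
-- differ by exactly as much as the ranks.

module Submission where

open import Defs hiding (sym)
open import Algebra.Bundles using (CommutativeRing)
open import Algebra.Properties.Group using (inverseʳ-unique)
import Algebra.Properties.Monoid.Sum as MonoidSum
import Algebra.Properties.Semiring.Sum as SemiringSum
open import Data.Bool using (Bool; true; false; not; _∧_; _∨_; if_then_else_; T)
open import Data.Bool.Properties using (T-∧; T-∨; T-≡; T-not-≡; ∧-comm; ∨-comm; ∧-zeroʳ; ¬-not) renaming (_≟_ to _≟ᵇ_)
open import Data.Empty using (⊥-elim)
open import Data.Fin using (Fin; zero; suc; toℕ; fromℕ; fromℕ<; inject₁; punchIn; punchOut)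
open import Data.Fin.Properties
  using (_≟_; any?; all?; ¬∀⟶∃¬; injective⇒≤; suc-injective; toℕ-injective; toℕ<n; toℕ-fromℕ<; toℕ-fromℕ; toℕ-inject₁;
         punchIn-punchOut)
import Data.Nat as ℕ
open import Data.Nat using (ℕ; zero; suc; _<_; _≤_; _≤?_; z≤n; s≤s; _+_; _∸_; ∣_-_∣)
open import Data.Nat.Divisibility using (_∣_; _∣?_; _∣0; ∣-refl; ∣m∣n⇒∣m+n; divides-refl)
open import Data.Nat.Induction using (<-wellFounded)
open import Data.Nat.Properties
  using (≤-refl; ≤-trans; ≤-antisym; ≤∧≢⇒<; ≮⇒≥; n≮n; m<1+n⇒m<n∨m≡n; m≤n⇒∃[o]m+o≡n; +-0-monoid; +-suc; +-comm;
         +-identityʳ; +-cancelʳ-≡; +-mono-≤; +-mono-<-≤; +-mono-≤-<; +-monoˡ-<; m∸n≤m; m∸[m∸n]≡n; m≤n+o⇒m∸n≤o;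
         ∣m-n∣≡[m∸n]∨[n∸m]; m≤n⇒∣n-m∣≡n∸m; m≤n⇒∣m-n∣≡n∸m; *-distribʳ-∣-∣)
  renaming (_≟_ to _≟ℕ_)
open import Data.Product using (Σ; Σ-syntax; ∃-syntax; _×_; _,_; proj₁; proj₂)
open import Data.Rational using (ℚ; 0ℚ; 1ℚ; _*_; -_; _-_; 1/_; ≢-nonZero) renaming (_+_ to _+ℚ_)
import Data.Rational.Properties as ℚ
open import Data.Rational.Properties
  using (+-*-commutativeRing; +-0-group; +-identityˡ; *-identityˡ; *-zeroˡ; *-zeroʳ; *-assoc; *-comm; *-inverseˡ)
  renaming (_≟_ to _≟ℚ_)
open import Data.Rational.Solver using (module +-*-Solver)
open import Data.Sum using (_⊎_; inj₁; inj₂; [_,_]′) renaming (map to ⊎-map)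
open import Data.Unit using (tt)
open import Data.Vec.Functional using (_∷_)
open import Effect.Monad using (RawMonad)
open import Function using (_∘_; id; Injective; Equivalence)
open import Induction.WellFounded using (Acc; acc)
open import Level using (0ℓ)
open import Relation.Binary.PropositionalEquality
  using (_≡_; _≢_; refl; sym; trans; cong; cong₂; subst; subst₂; module ≡-Reasoning)
open import Relation.Nullary using (¬_; Dec; yes; no; contradiction; ¬?)
open import Relation.Nullary.Decidable
  using (⌊_⌋; map′; toWitness; decidable-stable; ¬¬-excluded-middle; _×-dec_; _→-dec_)
open import Relation.Nullary.Negation using (¬¬-Monad; ¬¬-map)

module Σℚ = SemiringSum (CommutativeRing.semiring +-*-commutativeRing)
open MonoidSum +-0-monoid using (sum; sum-syntax)
open RawMonad (¬¬-Monad {0ℓ}) using (_>>=_; return)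
open +-*-Solver using (solve; _:+_; _:*_; :-_; _:-_; _:=_; con)
open Equivalence using (to; from)
open ≡-Reasoning

-- adjMatrix A i j unfolds to χ (A i j), so cong χ turns adjacency facts into matrix entries.
χ : Bool → ℚ
χ b = if b then 1ℚ else 0ℚ

1ℚ≢0ℚ : 1ℚ ≢ 0ℚ
1ℚ≢0ℚ ()

*-≢0 : ∀ {x y} → x ≢ 0ℚ → y ≢ 0ℚ → x * y ≢ 0ℚ
*-≢0 {x} {y} x≢0 y≢0 xy≡0 = y≢0 (begin
  y                  ≡⟨ sym (*-identityˡ y) ⟩
  1ℚ * y             ≡⟨ cong (_* y) (sym (*-inverseˡ x)) ⟩
  (x⁻¹ * x) * y      ≡⟨ *-assoc x⁻¹ x y ⟩
  x⁻¹ * (x * y)      ≡⟨ cong (x⁻¹ *_) xy≡0 ⟩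
  x⁻¹ * 0ℚ           ≡⟨ *-zeroʳ x⁻¹ ⟩
  0ℚ                 ∎)
  where
  instance _ = ≢-nonZero x≢0
  x⁻¹ = 1/ x

sumFin≡sum : ∀ m (f : Fin m → ℚ) → sumFin m f ≡ Σℚ.sum f
sumFin≡sum zero    f = refl
sumFin≡sum (suc m) f = cong (f zero +ℚ_) (sumFin≡sum m (f ∘ suc))

sumFin-cong : ∀ m {f g : Fin m → ℚ} → (∀ i → f i ≡ g i) → sumFin m f ≡ sumFin m g
sumFin-cong m {f} {g} f≗g rewrite sumFin≡sum m f | sumFin≡sum m g = Σℚ.sum-cong-≗ f≗g

sumFin-zero : ∀ m {f : Fin m → ℚ} → (∀ i → f i ≡ 0ℚ) → sumFin m f ≡ 0ℚ
sumFin-zero m f≗0 = trans (sumFin-cong m f≗0) (trans (sumFin≡sum m _) (Σℚ.sum-replicate-zero m))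

sumFin-+ : ∀ m (f g : Fin m → ℚ) → sumFin m (λ i → f i +ℚ g i) ≡ sumFin m f +ℚ sumFin m g
sumFin-+ m f g rewrite sumFin≡sum m f | sumFin≡sum m g | sumFin≡sum m (λ i → f i +ℚ g i) = Σℚ.∑-distrib-+ f g

sumFin-*ˡ : ∀ m x (f : Fin m → ℚ) → sumFin m (λ i → x * f i) ≡ x * sumFin m f
sumFin-*ˡ m x f rewrite sumFin≡sum m f | sumFin≡sum m (λ i → x * f i) = sym (Σℚ.*-distribˡ-sum x f)

sumFin-*ʳ : ∀ m x (f : Fin m → ℚ) → sumFin m (λ i → f i * x) ≡ sumFin m f * x
sumFin-*ʳ m x f = trans (sumFin-cong m (λ i → *-comm (f i) x)) (trans (sumFin-*ˡ m x f) (*-comm x _))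

sumFin-comm : ∀ m k (f : Fin m → Fin k → ℚ) →
  sumFin m (λ i → sumFin k (f i)) ≡ sumFin k (λ j → sumFin m (λ i → f i j))
sumFin-comm m k f = begin
  sumFin m (λ i → sumFin k (f i))          ≡⟨ sumFin-cong m (λ i → sumFin≡sum k (f i)) ⟩
  sumFin m (λ i → Σℚ.sum (f i))            ≡⟨ sumFin≡sum m _ ⟩
  Σℚ.sum (λ i → Σℚ.sum (f i))              ≡⟨ Σℚ.∑-comm f ⟩
  Σℚ.sum (λ j → Σℚ.sum (λ i → f i j))      ≡⟨ sym (sumFin≡sum k _) ⟩
  sumFin k (λ j → Σℚ.sum (λ i → f i j))    ≡⟨ sumFin-cong k (λ j → sym (sumFin≡sum m (λ i → f i j))) ⟩
  sumFin k (λ j → sumFin m (λ i → f i j))  ∎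

combination : ∀ {m} {X : Set} → (Fin m → ℚ) → (Fin m → X → ℚ) → X → ℚ
combination {m} c v x = sumFin m (λ j → c j * v j x)

Dependent : ∀ {m} {X : Set} → (Fin m → X → ℚ) → Set
Dependent {m} v = Σ[ c ∈ (Fin m → ℚ) ] (∀ x → combination c v x ≡ 0ℚ) × (∃[ j ] c j ≢ 0ℚ)

InSpan : ∀ {m} {X : Set} → (Fin m → X → ℚ) → (X → ℚ) → Set
InSpan {m} v w = Σ[ β ∈ (Fin m → ℚ) ] (∀ x → w x ≡ combination β v x)

unitVector : ∀ {m} → Fin m → Fin m → ℚ
unitVector zero    zero    = 1ℚ
unitVector zero    (suc k) = 0ℚ
unitVector (suc j) zero    = 0ℚ
unitVector (suc j) (suc k) = unitVector j k

unitVector-≢0 : ∀ {m} (j : Fin m) → unitVector j j ≢ 0ℚ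
unitVector-≢0 zero    = 1ℚ≢0ℚ
unitVector-≢0 (suc j) = unitVector-≢0 j

combination-unitVector : ∀ {m} {X : Set} (v : Fin m → X → ℚ) j x →
  combination (unitVector j) v x ≡ v j x
combination-unitVector {suc m} v zero x = begin
  1ℚ * v zero x +ℚ sumFin m (λ k → 0ℚ * v (suc k) x)
    ≡⟨ cong₂ _+ℚ_ (*-identityˡ (v zero x)) (sumFin-zero m (λ k → *-zeroˡ (v (suc k) x))) ⟩
  v zero x +ℚ 0ℚ
    ≡⟨ ℚ.+-identityʳ (v zero x) ⟩
  v zero x ∎
combination-unitVector {suc m} v (suc j) x =
  trans (cong (_+ℚ combination (unitVector j) (v ∘ suc) x) (*-zeroˡ (v zero x)))
    (trans (+-identityˡ _) (combination-unitVector (v ∘ suc) j x))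

zero-vector⇒dependent : ∀ {m} {X : Set} (v : Fin m → X → ℚ) j → (∀ x → v j x ≡ 0ℚ) → Dependent v
zero-vector⇒dependent v j vⱼ≡0 =
  unitVector j , (λ x → trans (combination-unitVector v j x) (vⱼ≡0 x)) , j , unitVector-≢0 j

-- One step of Gaussian elimination: the pivot v 0 j₀ clears coordinate j₀ from v 1, …, v m.
module _ {k m} (v : Fin (suc m) → Fin (suc k) → ℚ) (j₀ : Fin (suc k)) where

  eliminated : Fin m → Fin k → ℚ
  eliminated i j = v zero j₀ * v (suc i) (punchIn j₀ j) +ℚ - (v (suc i) j₀ * v zero (punchIn j₀ j))

  pivot-elimination : v zero j₀ ≢ 0ℚ → Dependent eliminated → Dependent v
  pivot-elimination α≢0 (d , d·w≡0 , i , dᵢ≢0) = c , c·v≡0 , suc i , *-≢0 α≢0 dᵢ≢0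
    where
    α = v zero j₀
    D : Fin (suc k) → ℚ
    D = combination d (v ∘ suc)
    c : Fin (suc m) → ℚ
    c = (- D j₀) ∷ (λ i → α * d i)
    c·v : ∀ j → combination c v j ≡ - D j₀ * v zero j +ℚ α * D j
    c·v j = cong (- D j₀ * v zero j +ℚ_)
      (trans (sumFin-cong m (λ i → *-assoc α (d i) _)) (sumFin-*ˡ m α _))
    d·w : ∀ j → combination d eliminated j ≡ α * D (punchIn j₀ j) +ℚ - v zero (punchIn j₀ j) * D j₀
    d·w j = begin
      sumFin m (λ i → d i * (α * x i +ℚ - (y i * z)))
        ≡⟨ sumFin-cong m (λ i →
             solve 5 (λ d α x y z → d :* (α :* x :+ :- (y :* z)) := α :* (d :* x) :+ (:- z) :* (d :* y))
               refl (d i) α (x i) (y i) z) ⟩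
      sumFin m (λ i → α * (d i * x i) +ℚ - z * (d i * y i))
        ≡⟨ sumFin-+ m _ _ ⟩
      sumFin m (λ i → α * (d i * x i)) +ℚ sumFin m (λ i → - z * (d i * y i))
        ≡⟨ cong₂ _+ℚ_ (sumFin-*ˡ m α _) (sumFin-*ˡ m (- z) _) ⟩
      α * D (punchIn j₀ j) +ℚ - z * D j₀ ∎
      where
      x = λ i → v (suc i) (punchIn j₀ j)
      y = λ i → v (suc i) j₀
      z = v zero (punchIn j₀ j)
    c·v≡0 : ∀ j → combination c v j ≡ 0ℚ
    c·v≡0 j with j₀ ≟ j
    ... | yes refl = trans (c·v j₀) (solve 2 (λ t a → (:- t) :* a :+ a :* t := con 0ℚ) refl (D j₀) α)
    ... | no j₀≢j = begin
      combination c v j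
        ≡⟨ c·v j ⟩
      - D j₀ * v zero j +ℚ α * D j
        ≡⟨ solve 4 (λ t a s b → (:- t) :* b :+ a :* s := a :* s :+ (:- b) :* t) refl (D j₀) α (D j) (v zero j) ⟩
      α * D j +ℚ - v zero j * D j₀
        ≡⟨ cong (λ j → α * D j +ℚ - v zero j * D j₀) (sym (punchIn-punchOut j₀≢j)) ⟩
      α * D (punchIn j₀ j′) +ℚ - v zero (punchIn j₀ j′) * D j₀
        ≡⟨ sym (d·w j′) ⟩
      combination d eliminated j′
        ≡⟨ d·w≡0 j′ ⟩
      0ℚ ∎
      where j′ = punchOut j₀≢j

k<m⇒dependent : ∀ {k m} → k < m → (v : Fin m → Fin k → ℚ) → Dependent v
k<m⇒dependent {zero}  {suc m} _          v = (λ _ → 1ℚ) , (λ ()) , zero , 1ℚ≢0ℚ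
k<m⇒dependent {suc k} {suc m} (s≤s k<m) v with any? (λ j → ¬? (v zero j ≟ℚ 0ℚ))
... | yes (j₀ , v₀j₀≢0) = pivot-elimination v j₀ v₀j₀≢0 (k<m⇒dependent k<m (eliminated v j₀))
... | no  v₀≢0 = zero-vector⇒dependent v zero
                   (λ j → decidable-stable (v zero j ≟ℚ 0ℚ) (λ v₀j≢0 → v₀≢0 (j , v₀j≢0)))

dependent-in-span-of-fewer : ∀ {k m} {X : Set} → k < m → (w : Fin k → X → ℚ) (v : Fin m → X → ℚ)
  (a : Fin m → Fin k → ℚ) → (∀ i x → v i x ≡ combination (a i) w x) → Dependent v
dependent-in-span-of-fewer {k} {m} k<m w v a v≡a·w with k<m⇒dependent k<m a
... | c , c·a≡0 , nontrivial = c , c·v≡0 , nontrivial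
  where
  c·v≡0 : ∀ x → combination c v x ≡ 0ℚ
  c·v≡0 x = begin
    sumFin m (λ i → c i * v i x)
      ≡⟨ sumFin-cong m (λ i → trans (cong (c i *_) (v≡a·w i x)) (sym (sumFin-*ˡ k (c i) _))) ⟩
    sumFin m (λ i → sumFin k (λ j → c i * (a i j * w j x)))
      ≡⟨ sumFin-comm m k _ ⟩
    sumFin k (λ j → sumFin m (λ i → c i * (a i j * w j x)))
      ≡⟨ sumFin-cong k (λ j → trans (sumFin-cong m (λ i → sym (*-assoc (c i) _ _))) (sumFin-*ʳ m (w j x) _)) ⟩
    sumFin k (λ j → combination c a j * w j x)
      ≡⟨ sumFin-zero k (λ j → trans (cong (_* w j x) (c·a≡0 j)) (*-zeroˡ (w j x))) ⟩
    0ℚ ∎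

Matrix : ℕ → Set
Matrix n = Fin n → Fin n → ℚ

column : ∀ {n} → Matrix n → Fin n → Fin n → ℚ
column M j i = M i j

module _ {n} {M : Matrix n} where

  dependent⇒¬independent : ∀ {r} {σ : Fin r → Fin n} → Dependent (column M ∘ σ) → ¬ LinIndepCols M r σ
  dependent⇒¬independent (c , c·M≡0 , j , cⱼ≢0) independent = cⱼ≢0 (independent c c·M≡0 j)

  independent-tail : ∀ {t} {σ : Fin (suc t) → Fin n} → LinIndepCols M (suc t) σ → LinIndepCols M t (σ ∘ suc)
  independent-tail {σ = σ} independent c c·M≡0 j = independent (0ℚ ∷ c) 0∷c·M≡0 (suc j)
    where
    0∷c·M≡0 : ∀ i → combination (0ℚ ∷ c) (column M ∘ σ) i ≡ 0ℚ
    0∷c·M≡0 i = trans (cong (_+ℚ combination c (column M ∘ σ ∘ suc) i) (*-zeroˡ (M i (σ zero))))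
      (trans (+-identityˡ _) (c·M≡0 i))

  independent-avoids-zero-column : ∀ {t} {σ : Fin t → Fin n} → LinIndepCols M t σ →
    ∀ x → (∀ i → M i x ≡ 0ℚ) → ∀ j → σ j ≢ x
  independent-avoids-zero-column {σ = σ} independent x Mx≡0 j refl = dependent⇒¬independent
    (zero-vector⇒dependent (column M ∘ σ) j Mx≡0) independent

  independent⇒≤rank : ∀ {r t} {σ : Fin t → Fin n} → IsRank M r →
    Injective _≡_ _≡_ σ → LinIndepCols M t σ → t ≤ r
  independent⇒≤rank {t = zero} _ _ _ = z≤n
  independent⇒≤rank {r} {suc t} {σ} rank@(_ , maximal) σ-injective independent with t ≟ℕ r
  ... | yes refl = contradiction independent (maximal σ σ-injective)
  ... | no  t≢r  = ≤∧≢⇒< (independent⇒≤rank rank (λ e → suc-injective (σ-injective e))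
                                              (independent-tail {σ = σ} independent)) t≢r

-- IsRank asks for a largest independent family, whose existence is classical: the results
-- below hold under double negation, which costs nothing since everything concluded from
-- them (inequalities and divisibility in ℕ) is decidable.
¬¬-∀-Fin : ∀ {n} {P : Fin n → Set} → (∀ i → ¬ ¬ P i) → ¬ ¬ (∀ i → P i)
¬¬-∀-Fin {zero}  _   = return (λ ())
¬¬-∀-Fin {suc n} ¬¬P = do
  p₀ ← ¬¬P zero
  pₛ ← ¬¬-∀-Fin (¬¬P ∘ suc)
  return λ where
    zero    → p₀
    (suc i) → pₛ i

¬¬-maximal : (P : ℕ → Set) → ∀ k {s} → P s → (∀ {t} → P t → t ≤ k + s) → ¬ ¬ (∃[ t ] P t × ¬ P (suc t))
¬¬-maximal P zero    {s} pₛ bound = return (s , pₛ , λ pₛ₊₁ → n≮n s (bound pₛ₊₁))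
¬¬-maximal P (suc k) {s} pₛ bound = ¬¬-excluded-middle >>= λ where
  (yes pₛ₊₁) → ¬¬-maximal P k pₛ₊₁ (λ {t} pₜ → subst (t ≤_) (sym (+-suc k s)) (bound pₜ))
  (no ¬pₛ₊₁) → return (s , pₛ , ¬pₛ₊₁)

rank-exists : ∀ {n} (M : Matrix n) → ¬ ¬ (∃[ r ] IsRank M r)
rank-exists {n} M = ¬¬-map toRank (¬¬-maximal IndependentFamily n empty bound)
  where
  IndependentFamily : ℕ → Set
  IndependentFamily t = Σ[ σ ∈ (Fin t → Fin n) ] Injective _≡_ _≡_ σ × LinIndepCols M t σ
  empty : IndependentFamily 0
  empty = (λ ()) , (λ {}) , (λ _ _ ())
  bound : ∀ {t} → IndependentFamily t → t ≤ n + 0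
  bound (_ , σ-injective , _) = subst (_ ≤_) (sym (+-identityʳ n)) (injective⇒≤ σ-injective)
  toRank : ∃[ r ] IndependentFamily r × ¬ IndependentFamily (suc r) → ∃[ r ] IsRank M r
  toRank (r , basis , ¬larger) = r , basis , λ σ σ-injective independent → ¬larger (σ , σ-injective , independent)

rank≤n : ∀ {n r} (M : Matrix n) → IsRank M r → r ≤ n
rank≤n M ((_ , σ-injective , _) , _) = injective⇒≤ σ-injective

leading-in-span : ∀ {m} {X : Set} (c : Fin (suc m) → ℚ) (u : X → ℚ) (v : Fin m → X → ℚ) →
  c zero ≢ 0ℚ → (∀ x → combination c (u ∷ v) x ≡ 0ℚ) → InSpan v u
leading-in-span {m} c u v c₀≢0 c·uv≡0 = β , λ x → sym (β·v≡u x)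
  where
  instance _ = ≢-nonZero c₀≢0
  c₀⁻¹ = 1/ c zero
  β : Fin m → ℚ
  β k = - (c₀⁻¹ * c (suc k))
  β·v≡u : ∀ x → combination β v x ≡ u x
  β·v≡u x = begin
    sumFin m (λ k → - (c₀⁻¹ * c (suc k)) * v k x)
      ≡⟨ sumFin-cong m (λ k →
           solve 3 (λ a b d → (:- (a :* b)) :* d := (:- a) :* (b :* d)) refl c₀⁻¹ (c (suc k)) (v k x)) ⟩
    sumFin m (λ k → - c₀⁻¹ * (c (suc k) * v k x))
      ≡⟨ sumFin-*ˡ m (- c₀⁻¹) _ ⟩
    - c₀⁻¹ * combination (c ∘ suc) v x
      ≡⟨ cong (- c₀⁻¹ *_) (inverseʳ-unique +-0-group (c zero * u x) _ (c·uv≡0 x)) ⟩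
    - c₀⁻¹ * - (c zero * u x)
      ≡⟨ solve 3 (λ a b d → (:- a) :* (:- (b :* d)) := (a :* b) :* d) refl c₀⁻¹ (c zero) (u x) ⟩
    (c₀⁻¹ * c zero) * u x
      ≡⟨ cong (_* u x) (*-inverseˡ (c zero)) ⟩
    1ℚ * u x
      ≡⟨ *-identityˡ (u x) ⟩
    u x ∎

∷-injective : ∀ {n t} {x : Fin n} {σ : Fin t → Fin n} →
  Injective _≡_ _≡_ σ → (∀ j → σ j ≢ x) → Injective _≡_ _≡_ (x ∷ σ)
∷-injective σ-injective σ≢x {zero}  {zero}  _ = refl
∷-injective σ-injective σ≢x {zero}  {suc j} e = contradiction (sym e) (σ≢x j)
∷-injective σ-injective σ≢x {suc i} {zero}  e = contradiction e (σ≢x i)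
∷-injective σ-injective σ≢x {suc i} {suc j} e = cong suc (σ-injective e)

module _ {n} {M : Matrix n} where

  ¬InSpan⇒independent-∷ : ∀ {r x} {σ : Fin r → Fin n} → LinIndepCols M r σ →
    ¬ InSpan (column M ∘ σ) (column M x) → LinIndepCols M (suc r) (x ∷ σ)
  ¬InSpan⇒independent-∷ {r} {x} {σ} independent ¬span c c·M≡0 = λ where
      zero    → c₀≡0
      (suc j) → independent (c ∘ suc) tail≡0 j
    where
    c₀≡0 : c zero ≡ 0ℚ
    c₀≡0 = decidable-stable (c zero ≟ℚ 0ℚ) λ c₀≢0 →
      ¬span (leading-in-span c (column M x) (column M ∘ σ) c₀≢0 c·M≡0)
    tail≡0 : ∀ i → combination (c ∘ suc) (column M ∘ σ) i ≡ 0ℚ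
    tail≡0 i = begin
      tail·M i                    ≡⟨ sym (+-identityˡ _) ⟩
      0ℚ +ℚ tail·M i              ≡⟨ cong (_+ℚ tail·M i) (sym (trans (cong (_* M i x) c₀≡0) (*-zeroˡ (M i x)))) ⟩
      c zero * M i x +ℚ tail·M i  ≡⟨ c·M≡0 i ⟩
      0ℚ                          ∎
      where tail·M = combination (c ∘ suc) (column M ∘ σ)

  basis-spans : ∀ {r} (rank : IsRank M r) → ∀ x → ¬ ¬ InSpan (column M ∘ proj₁ (proj₁ rank)) (column M x)
  basis-spans ((σ , σ-injective , independent) , maximal) x with any? (λ j → σ j ≟ x)
  ... | yes (j , refl) = return (unitVector j , λ i → sym (combination-unitVector (column M ∘ σ) j i))
  ... | no  x∉σ = λ ¬span → maximal (x ∷ σ) (∷-injective σ-injective (λ j σⱼ≡x → x∉σ (j , σⱼ≡x)))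
                    (¬InSpan⇒independent-∷ independent ¬span)

rank-one-update : ∀ {n r r′} {M N : Matrix n} (E γ : Fin n → ℚ) → (∀ i j → N i j ≡ M i j +ℚ γ j * E i) →
  IsRank M r → IsRank N r′ → r′ ≤ suc r
rank-one-update {n} {r} {r′} {M} {N} E γ N≡M+γE rankM@((σ , _ , _) , _) ((τ , _ , τ-independent) , _) =
  decidable-stable (r′ ≤? suc r) (¬¬-map bound (¬¬-∀-Fin (basis-spans rankM)))
  where
  bound : (∀ x → InSpan (column M ∘ σ) (column M x)) → r′ ≤ suc r
  bound spans = ≮⇒≥ λ r<r′ → dependent⇒¬independent {M = N} {σ = τ}
    (dependent-in-span-of-fewer r<r′ w (column N ∘ τ) a Nτ≡a·w) τ-independent
    where
    w : Fin (suc r) → Fin n → ℚ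
    w = E ∷ (column M ∘ σ)
    a : Fin r′ → Fin (suc r) → ℚ
    a j = γ (τ j) ∷ proj₁ (spans (τ j))
    Nτ≡a·w : ∀ j i → N i (τ j) ≡ combination (a j) w i
    Nτ≡a·w j i = begin
      N i (τ j)                           ≡⟨ N≡M+γE i (τ j) ⟩
      M i (τ j) +ℚ γ (τ j) * E i          ≡⟨ cong (_+ℚ γ (τ j) * E i) (β·M≡Mτ i) ⟩
      β·M i +ℚ γ (τ j) * E i              ≡⟨ ℚ.+-comm (β·M i) (γ (τ j) * E i) ⟩
      γ (τ j) * E i +ℚ β·M i              ∎
      where
      β·M = combination (proj₁ (spans (τ j))) (column M ∘ σ)
      β·M≡Mτ = proj₂ (spans (τ j))

rank-two-update : ∀ {n r r′} {M N : Matrix n} (E₁ γ₁ E₂ γ₂ : Fin n → ℚ) →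
  (∀ i j → N i j ≡ M i j +ℚ γ₁ j * E₁ i +ℚ γ₂ j * E₂ i) → IsRank M r → IsRank N r′ → r′ ≤ 2 + r
rank-two-update {n} {r} {r′} {M} {N} E₁ γ₁ E₂ γ₂ N≡M+γE rankM rankN = decidable-stable (r′ ≤? 2 + r) do
  (s , rankL) ← rank-exists L
  return (≤-trans (rank-one-update {M = L} {N} E₂ γ₂ N≡M+γE rankL rankN)
                  (s≤s (rank-one-update {M = M} {L} E₁ γ₁ (λ _ _ → refl) rankM rankL)))
  where
  L : Matrix n
  L i j = M i j +ℚ γ₁ j * E₁ i

∣m-n∣≤o : ∀ {m n o} → m ≤ o + n → n ≤ o + m → ∣ m - n ∣ ≤ o
∣m-n∣≤o {m} {n} {o} m≤o+n n≤o+m = [ bounded m n m≤o+n , bounded n m n≤o+m ]′ (∣m-n∣≡[m∸n]∨[n∸m] m n)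
  where
  bounded : ∀ a b → a ≤ o + b → ∣ m - n ∣ ≡ a ∸ b → ∣ m - n ∣ ≤ o
  bounded a b a≤o+b e = subst (_≤ o) (sym e) (m≤n+o⇒m∸n≤o a b (subst (a ≤_) (+-comm o b) a≤o+b))

rank-two-update⇒∣-∣≤2 : ∀ {n r r′} {M N : Matrix n} (E₁ γ₁ E₂ γ₂ : Fin n → ℚ) →
  (∀ i j → N i j ≡ M i j +ℚ γ₁ j * E₁ i +ℚ γ₂ j * E₂ i) → IsRank M r → IsRank N r′ → ∣ r′ - r ∣ ≤ 2
rank-two-update⇒∣-∣≤2 {M = M} {N} E₁ γ₁ E₂ γ₂ N≡M+γE rankM rankN = ∣m-n∣≤o
  (rank-two-update {M = M} {N} E₁ γ₁ E₂ γ₂ N≡M+γE rankM rankN)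
  (rank-two-update {M = N} {M} E₁ (-_ ∘ γ₁) E₂ (-_ ∘ γ₂) M≡N-γE rankN rankM)
  where
  M≡N-γE : ∀ i j → M i j ≡ N i j +ℚ - γ₁ j * E₁ i +ℚ - γ₂ j * E₂ i
  M≡N-γE i j rewrite N≡M+γE i j = solve 5 (λ m a b c d → m := m :+ a :* b :+ c :* d :+ (:- a) :* b :+ (:- c) :* d)
    refl (M i j) (γ₁ j) (E₁ i) (γ₂ j) (E₂ i)

-- Forests with an edge have a leaf

record NonBacktrackingWalk {n} (A : Fin n → Fin n → Bool) : Set where
  field
    vertex       : ℕ → Fin n
    adjacent     : ∀ k → A (vertex k) (vertex (suc k)) ≡ true
    no-backtrack : ∀ k → vertex (2 + k) ≢ vertex k

record Repetition {n} (y : ℕ → Fin n) : Set where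
  field
    first second    : ℕ
    first<second    : first < second
    repeated        : y first ≡ y second
    injective-below : ∀ {a b} → a < second → b < second → y a ≡ y b → a ≡ b

module _ {n} (y : ℕ → Fin n) where

  InjectiveBelow : ℕ → Set
  InjectiveBelow k = ∀ {a b} → a < k → b < k → y a ≡ y b → a ≡ b

  injective-below-or-repetition : ∀ k → InjectiveBelow k ⊎ Repetition y
  injective-below-or-repetition zero = inj₁ (λ ())
  injective-below-or-repetition (suc k) with injective-below-or-repetition k
  ... | inj₂ repetition = inj₂ repetition
  ... | inj₁ injective with any? (λ (a : Fin k) → y (toℕ a) ≟ y k)
  ...   | yes (a , yₐ≡yₖ) = inj₂ (record
          { first = toℕ a ; second = k ; first<second = toℕ<n a ; repeated = yₐ≡yₖ ; injective-below = injective })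
  ...   | no  fresh = inj₁ (λ a<1+k b<1+k → extend (m<1+n⇒m<n∨m≡n a<1+k) (m<1+n⇒m<n∨m≡n b<1+k))
    where
    fresh′ : ∀ {a} → a < k → y a ≢ y k
    fresh′ a<k yₐ≡yₖ = fresh (fromℕ< a<k , subst (λ a → y a ≡ y k) (sym (toℕ-fromℕ< a<k)) yₐ≡yₖ)
    extend : ∀ {a b} → a < k ⊎ a ≡ k → b < k ⊎ b ≡ k → y a ≡ y b → a ≡ b
    extend (inj₁ a<k)  (inj₁ b<k)  = injective a<k b<k
    extend (inj₁ a<k)  (inj₂ refl) = λ yₐ≡yₖ → contradiction yₐ≡yₖ (fresh′ a<k)
    extend (inj₂ refl) (inj₁ b<k)  = λ yₖ≡y_b → contradiction (sym yₖ≡y_b) (fresh′ b<k)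
    extend (inj₂ refl) (inj₂ refl) = λ _ → refl

  repetition : Repetition y
  repetition with injective-below-or-repetition (suc n)
  ... | inj₂ repetition = repetition
  ... | inj₁ injective =
    contradiction (injective⇒≤ {f = y ∘ toℕ} (λ e → toℕ-injective (injective (toℕ<n _) (toℕ<n _) e))) (n≮n n)

-- The first repetition y i ≡ y J closes the cycle y i, …, y (J − 1), which has at least three
-- vertices because A is irreflexive and the walk never backtracks.
walk⇒cycle : ∀ {n} {A : Fin n → Fin n → Bool} → (∀ i → A i i ≡ false) → NonBacktrackingWalk A → Cycle A
walk⇒cycle {n} {A} irreflexive walk =
  record { k = k ; v = v ; inj = v-injective ; step = v-step ; close = v-close }
  where
  open NonBacktrackingWalk walk renaming (vertex to y)
  open Repetition (repetition y) renaming (first to i; second to J)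
  J≢1+i : J ≢ suc i
  J≢1+i J≡1+i with (begin
    true                 ≡⟨ sym (adjacent i) ⟩
    A (y i) (y (suc i))  ≡⟨ cong (A (y i) ∘ y) (sym J≡1+i) ⟩
    A (y i) (y J)        ≡⟨ cong (A (y i)) (sym repeated) ⟩
    A (y i) (y i)        ≡⟨ irreflexive (y i) ⟩
    false                ∎)
  ... | ()
  J≢2+i : J ≢ 2 + i
  J≢2+i J≡2+i = no-backtrack i (trans (cong y (sym J≡2+i)) (sym repeated))
  3+i≤J : 3 + i ≤ J
  3+i≤J = ≤∧≢⇒< (≤∧≢⇒< first<second (J≢1+i ∘ sym)) (J≢2+i ∘ sym)
  k : ℕ
  k = proj₁ (m≤n⇒∃[o]m+o≡n 3+i≤J)
  3+k+i≡J : 3 + k + i ≡ J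
  3+k+i≡J = trans (cong (3 +_) (+-comm k i)) (proj₂ (m≤n⇒∃[o]m+o≡n 3+i≤J))
  v : Fin (3 + k) → Fin n
  v t = y (toℕ t + i)
  below : ∀ t → toℕ t + i < J
  below t = subst (toℕ t + i <_) 3+k+i≡J (+-monoˡ-< i (toℕ<n t))
  v-injective : Injective _≡_ _≡_ v
  v-injective {t₁} {t₂} e = toℕ-injective (+-cancelʳ-≡ i _ _ (injective-below (below t₁) (below t₂) e))
  v-step : ∀ t → A (v (inject₁ t)) (v (suc t)) ≡ true
  v-step t = subst (λ a → A (y (a + i)) (y (suc (toℕ t + i))) ≡ true) (sym (toℕ-inject₁ t))
    (adjacent (toℕ t + i))
  v-close : A (v (fromℕ (2 + k))) (v zero) ≡ true
  v-close = subst₂ (λ a b → A (y (a + i)) b ≡ true) (sym (toℕ-fromℕ (2 + k)))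
    (trans (cong y 3+k+i≡J) (sym repeated)) (adjacent (2 + k + i))

record PendantEdge {n} (A : Fin n → Fin n → Bool) : Set where
  field
    leaf support   : Fin n
    leaf-support   : A leaf support ≡ true
    support-unique : ∀ w → A leaf w ≡ true → w ≡ support

pendantEdge? : ∀ {n} (A : Fin n → Fin n → Bool) → Dec (PendantEdge A)
pendantEdge? A = map′
  (λ (v , u , vu , unique) → record { leaf = v ; support = u ; leaf-support = vu ; support-unique = unique })
  (λ p → let open PendantEdge p in leaf , support , leaf-support , support-unique)
  (any? λ v → any? λ u → (A v u ≟ᵇ true) ×-dec all? (λ w → (A v w ≟ᵇ true) →-dec (w ≟ u)))

module _ {n} (G : Graph n) where

  private
    A = adj G

  no-pendant⇒continuation : ¬ PendantEdge A → ∀ {u v} → A u v ≡ true → ∃[ w ] A v w ≡ true × w ≢ u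
  no-pendant⇒continuation ¬pendant {u} {v} uv with all? (λ w → (A v w ≟ᵇ true) →-dec (w ≟ u))
  ... | yes unique = contradiction
    (record { leaf = v ; support = u ; leaf-support = trans (Graph.sym G v u) uv ; support-unique = unique }) ¬pendant
  ... | no ¬unique with ¬∀⟶∃¬ n _ (λ w → (A v w ≟ᵇ true) →-dec (w ≟ u)) ¬unique
  ...   | w , ¬[vw⇒w≡u] =
    w , decidable-stable (A v w ≟ᵇ true) (λ ¬vw → ¬[vw⇒w≡u] (λ vw → contradiction vw ¬vw))
      , λ w≡u → ¬[vw⇒w≡u] (λ _ → w≡u)

  nonBacktracking-walk : ¬ PendantEdge A → ∀ {p q} → A p q ≡ true → NonBacktrackingWalk A
  nonBacktracking-walk ¬pendant {p} {q} pq = record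
    { vertex       = λ k → proj₁ (proj₁ (walk k))
    ; adjacent     = λ k → proj₂ (walk k)
    ; no-backtrack = λ k → proj₂ (proj₂ (continue (proj₂ (walk k))))
    }
    where
    Edge = Σ (Fin n × Fin n) λ (u , v) → A u v ≡ true
    continue : ∀ {u v} → A u v ≡ true → ∃[ w ] A v w ≡ true × w ≢ u
    continue = no-pendant⇒continuation ¬pendant
    walk : ℕ → Edge
    walk zero    = (p , q) , pq
    walk (suc k) = let ((u , v) , uv) = walk k ; (w , vw , _) = continue uv in (v , w) , vw

  forest-pendantEdge : IsForest A → ∀ {p q} → A p q ≡ true → PendantEdge A
  forest-pendantEdge forest pq = decidable-stable (pendantEdge? A) λ ¬pendant →
    forest (walk⇒cycle (Graph.irrefl G) (nonBacktracking-walk ¬pendant pq))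

-- Forests have even rank

_⊆ᴱ_ : ∀ {n} → (Fin n → Fin n → Bool) → (Fin n → Fin n → Bool) → Set
B ⊆ᴱ A = ∀ {i j} → B i j ≡ true → A i j ≡ true

IsForest-⊆ᴱ : ∀ {n} {A B : Fin n → Fin n → Bool} → B ⊆ᴱ A → IsForest A → IsForest B
IsForest-⊆ᴱ B⊆A forest cycle = forest (record { k = k ; v = v ; inj = inj ; step = B⊆A ∘ step ; close = B⊆A close })
  where open Cycle cycle

∑-mono-≤ : ∀ {m} {f g : Fin m → ℕ} → (∀ i → f i ≤ g i) → sum f ≤ sum g
∑-mono-≤ {zero}  f≤g = z≤n
∑-mono-≤ {suc m} f≤g = +-mono-≤ (f≤g zero) (∑-mono-≤ (f≤g ∘ suc))

∑-mono-< : ∀ {m} {f g : Fin m → ℕ} → (∀ i → f i ≤ g i) → ∀ k → f k < g k → sum f < sum g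
∑-mono-< {suc m} f≤g zero    f₀<g₀ = +-mono-<-≤ f₀<g₀ (∑-mono-≤ (f≤g ∘ suc))
∑-mono-< {suc m} f≤g (suc k) fₖ<gₖ = +-mono-≤-< (f≤g zero) (∑-mono-< (f≤g ∘ suc) k fₖ<gₖ)

edgeCount : ∀ {n} → (Fin n → Fin n → Bool) → ℕ
edgeCount {n} A = ∑[ i < n ] ∑[ j < n ] (if A i j then 1 else 0)

edgeCount-< : ∀ {n} {A B : Fin n → Fin n → Bool} → B ⊆ᴱ A → ∀ {p q} → B p q ≡ false → A p q ≡ true →
  edgeCount B < edgeCount A
edgeCount-< {A = A} {B} B⊆A {p} {q} ¬Bpq Apq = ∑-mono-< (λ i → ∑-mono-≤ (entry≤ i)) p (∑-mono-< (entry≤ p) q entry<)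
  where
  entry≤ : ∀ i j → (if B i j then 1 else 0) ≤ (if A i j then 1 else 0)
  entry≤ i j with B i j in Bij
  ... | false = z≤n
  ... | true rewrite B⊆A Bij = ≤-refl
  entry< : (if B p q then 1 else 0) < (if A p q then 1 else 0)
  entry< rewrite ¬Bpq | Apq = ≤-refl

deleteStar : ∀ {n} → Graph n → Fin n → Graph n
deleteStar G u = record { adj = adj* ; sym = adj*-sym ; irrefl = adj*-irrefl }
  where
  adj* : _ → _ → Bool
  adj* i j = (not ⌊ i ≟ u ⌋ ∧ not ⌊ j ≟ u ⌋) ∧ adj G i j
  adj*-sym : ∀ i j → adj* i j ≡ adj* j i
  adj*-sym i j rewrite Graph.sym G i j | ∧-comm (not ⌊ i ≟ u ⌋) (not ⌊ j ≟ u ⌋) = refl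
  adj*-irrefl : ∀ i → adj* i i ≡ false
  adj*-irrefl i rewrite Graph.irrefl G i = ∧-zeroʳ _

module _ {n} (G : Graph n) (u : Fin n) where

  private
    A  = adj G
    A* = adj (deleteStar G u)

  deleteStar-⊆ᴱ : A* ⊆ᴱ A
  deleteStar-⊆ᴱ {i} {j} with not ⌊ i ≟ u ⌋ ∧ not ⌊ j ≟ u ⌋
  ... | true  = id
  ... | false = λ ()

  deleteStar-column : ∀ i → A* i u ≡ false
  deleteStar-column i with i ≟ u | u ≟ u
  ... | _     | no u≢u = contradiction refl u≢u
  ... | yes _ | yes _  = refl
  ... | no _  | yes _  = refl

  deleteStar-row : ∀ j → A* u j ≡ false
  deleteStar-row j with u ≟ u
  ... | no u≢u = contradiction refl u≢u
  ... | yes _  = refl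

  deleteStar-off : ∀ {i j} → i ≢ u → j ≢ u → A* i j ≡ A i j
  deleteStar-off {i} {j} i≢u j≢u with i ≟ u | j ≟ u
  ... | yes i≡u | _       = contradiction i≡u i≢u
  ... | no _    | yes j≡u = contradiction j≡u j≢u
  ... | no _    | no _    = refl

  deleteStar-update : ∀ i j → adjMatrix A i j ≡
    adjMatrix A* i j +ℚ adjMatrix A u j * χ ⌊ i ≟ u ⌋ +ℚ χ ⌊ j ≟ u ⌋ * adjMatrix A i u
  deleteStar-update i j with i ≟ u | j ≟ u
  ... | yes refl | yes refl rewrite Graph.irrefl G i = refl
  ... | yes refl | no j≢u =
    solve 2 (λ x y → x := con 0ℚ :+ x :* con 1ℚ :+ con 0ℚ :* y) refl (adjMatrix A i j) (adjMatrix A i i)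
  ... | no i≢u | yes refl =
    solve 2 (λ x y → x := con 0ℚ :+ y :* con 0ℚ :+ con 1ℚ :* x) refl (adjMatrix A i j) (adjMatrix A j j)
  ... | no i≢u | no j≢u = solve 3 (λ x y z → x := x :+ y :* con 0ℚ :+ con 0ℚ :* z)
    refl (adjMatrix A i j) (adjMatrix A u j) (adjMatrix A i u)

module PendantDeletion {n} (G : Graph n) (pendant : PendantEdge (adj G)) where

  open PendantEdge pendant renaming (leaf to v; support to u)

  G* : Graph n
  G* = deleteStar G u

  private
    A  = adj G
    A* = adj G*
    M  = adjMatrix A
    M* = adjMatrix A*

  v≢u : v ≢ u
  v≢u v≡u with trans (sym leaf-support) (trans (cong (A v) (sym v≡u)) (Graph.irrefl G v))
  ... | ()

  leaf-row : ∀ {j} → j ≢ u → A v j ≡ false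
  leaf-row {j} j≢u = ¬-not (λ vj → j≢u (support-unique j vj))

  leaf-column : ∀ {i} → i ≢ u → A i v ≡ false
  leaf-column {i} i≢u = trans (Graph.sym G i v) (leaf-row i≢u)

  deleteStar-leaf-column : ∀ i → A* i v ≡ false
  deleteStar-leaf-column i = by-cases (i ≟ u)
    where
    by-cases : Dec (i ≡ u) → A* i v ≡ false
    by-cases (yes refl) = deleteStar-row G u v
    by-cases (no  i≢u)  = trans (deleteStar-off G u i≢u v≢u) (leaf-column i≢u)

  edgeCount-deleteStar : edgeCount A* < edgeCount A
  edgeCount-deleteStar =
    edgeCount-< {A = A} {A*} (deleteStar-⊆ᴱ G u) (deleteStar-column G u v) leaf-support

  module _ {s} {σ : Fin s → Fin n} (σ-independent : LinIndepCols M* s σ) where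

    σ≢u : ∀ k → σ k ≢ u
    σ≢u = independent-avoids-zero-column {M = M*} σ-independent u (λ i → cong χ (deleteStar-column G u i))

    σ≢v : ∀ k → σ k ≢ v
    σ≢v = independent-avoids-zero-column {M = M*} σ-independent v (λ i → cong χ (deleteStar-leaf-column i))

    -- Row v isolates the coefficient of column u; the rows other than u then reduce to the
    -- independence of σ in G*, and finally row u isolates the coefficient of column v.
    u∷v∷σ-independent : LinIndepCols M (2 + s) (u ∷ v ∷ σ)
    u∷v∷σ-independent c c·M≡0 = λ where
        zero          → c₀≡0
        (suc zero)    → c₁≡0
        (suc (suc k)) → c′≡0 k
      where
      c₀ = c zero
      c₁ = c (suc zero)
      c′ : Fin s → ℚ
      c′ k = c (suc (suc k))
      S : Matrix n → Fin n → ℚ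
      S N = combination c′ (column N ∘ σ)
      row : ∀ i {p q t} → M i u ≡ p → M i v ≡ q → S M i ≡ t → c₀ * p +ℚ (c₁ * q +ℚ t) ≡ 0ℚ
      row i refl refl refl = c·M≡0 i
      c₀≡0 : c₀ ≡ 0ℚ
      c₀≡0 = begin
        c₀                            ≡⟨ solve 2 (λ a b → a := a :* con 1ℚ :+ (b :* con 0ℚ :+ con 0ℚ)) refl c₀ c₁ ⟩
        c₀ * 1ℚ +ℚ (c₁ * 0ℚ +ℚ 0ℚ)    ≡⟨ row v (cong χ leaf-support) (cong χ (leaf-row v≢u)) S-v≡0 ⟩
        0ℚ                            ∎
        where
        S-v≡0 = sumFin-zero s (λ k → trans (cong (c′ k *_) (cong χ (leaf-row (σ≢u k)))) (*-zeroʳ (c′ k)))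
      S*≡0 : ∀ i → S M* i ≡ 0ℚ
      S*≡0 i = by-cases (i ≟ u)
        where
        by-cases : Dec (i ≡ u) → S M* i ≡ 0ℚ
        by-cases (yes refl) =
          sumFin-zero s (λ k → trans (cong (c′ k *_) (cong χ (deleteStar-row G u (σ k)))) (*-zeroʳ (c′ k)))
        by-cases (no  i≢u)  = begin
          S M* i
            ≡⟨ sumFin-cong s (λ k → cong (c′ k *_) (cong χ (deleteStar-off G u i≢u (σ≢u k)))) ⟩
          S M i
            ≡⟨ solve 3 (λ a b x → x := con 0ℚ :* a :+ (b :* con 0ℚ :+ x)) refl (M i u) c₁ (S M i) ⟩
          0ℚ * M i u +ℚ (c₁ * 0ℚ +ℚ S M i)
            ≡⟨ cong (λ a → a * M i u +ℚ (c₁ * 0ℚ +ℚ S M i)) (sym c₀≡0) ⟩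
          c₀ * M i u +ℚ (c₁ * 0ℚ +ℚ S M i)
            ≡⟨ row i refl (cong χ (leaf-column i≢u)) refl ⟩
          0ℚ ∎
      c′≡0 : ∀ k → c′ k ≡ 0ℚ
      c′≡0 = σ-independent c′ S*≡0
      c₁≡0 : c₁ ≡ 0ℚ
      c₁≡0 = begin
        c₁
          ≡⟨ solve 2 (λ a b → b := con 0ℚ :* a :+ (b :* con 1ℚ :+ con 0ℚ)) refl (M u u) c₁ ⟩
        0ℚ * M u u +ℚ (c₁ * 1ℚ +ℚ 0ℚ)
          ≡⟨ cong (λ a → a * M u u +ℚ (c₁ * 1ℚ +ℚ 0ℚ)) (sym c₀≡0) ⟩
        c₀ * M u u +ℚ (c₁ * 1ℚ +ℚ 0ℚ)
          ≡⟨ row u refl (cong χ (trans (Graph.sym G u v) leaf-support)) S-u≡0 ⟩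
        0ℚ ∎
        where
        S-u≡0 = sumFin-zero s (λ k → trans (cong (_* M u (σ k)) (c′≡0 k)) (*-zeroˡ (M u (σ k))))

  rank-deleteStar : ∀ {r s} → IsRank M* s → IsRank M r → r ≡ 2 + s
  rank-deleteStar rank*@((σ , σ-injective , σ-independent) , _) rank = ≤-antisym
    (rank-two-update {M = M*} {M} (λ i → χ ⌊ i ≟ u ⌋) (M u) (λ i → M i u) (λ j → χ ⌊ j ≟ u ⌋)
      (deleteStar-update G u) rank* rank)
    (independent⇒≤rank {M = M} rank (∷-injective (∷-injective σ-injective (σ≢v σ-independent)) support≢)
      (u∷v∷σ-independent σ-independent))
    where
    support≢ : ∀ j → (v ∷ σ) j ≢ u
    support≢ zero    = v≢u
    support≢ (suc k) = σ≢u σ-independent k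

edgeless⇒rank≡0 : ∀ {n r} {A : Fin n → Fin n → Bool} → (∀ i j → A i j ≢ true) → IsRank (adjMatrix A) r → r ≡ 0
edgeless⇒rank≡0 {r = zero}  _ _ = refl
edgeless⇒rank≡0 {r = suc r} {A} edgeless ((σ , _ , independent) , _) = contradiction refl
  (independent-avoids-zero-column {M = adjMatrix A} {σ = σ} independent (σ zero)
    (λ i → cong χ (¬-not (edgeless i (σ zero)))) zero)

forest-rank-even : ∀ {n r} (G : Graph n) → IsForest (adj G) → IsRank (adjMatrix (adj G)) r → 2 ∣ r
forest-rank-even G = by-edge-count G (<-wellFounded _)
  where
  by-edge-count : ∀ {n r} (G : Graph n) → Acc _<_ (edgeCount (adj G)) →
    IsForest (adj G) → IsRank (adjMatrix (adj G)) r → 2 ∣ r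
  by-edge-count G (acc fewer-edges) forest rank with any? (λ p → any? (λ q → adj G p q ≟ᵇ true))
  ... | no  edgeless = subst (2 ∣_) (sym (edgeless⇒rank≡0 (λ p q pq → edgeless (p , q , pq)) rank)) (2 ∣0)
  ... | yes (p , q , pq) = decidable-stable (2 ∣? _) do
    (s , rank*) ← rank-exists (adjMatrix (adj G*))
    let 2∣s = by-edge-count G* (fewer-edges edgeCount-deleteStar)
                (IsForest-⊆ᴱ (deleteStar-⊆ᴱ G _) forest) rank*
    return (subst (2 ∣_) (sym (rank-deleteStar rank* rank)) (∣m∣n⇒∣m+n ∣-refl 2∣s))
    where open PendantDeletion G (forest-pendantEdge G forest pq)

-- The 2-switch is a rank-two update

Booleans : ℕ → Set
Booleans zero    = Bool
Booleans (suc k) = Bool → Booleans k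

Holds : ∀ k → Booleans k → Set
Holds zero    b = T b
Holds (suc k) f = ∀ x → Holds k (f x)

everywhere : ∀ k → Booleans k → Bool
everywhere zero    b = b
everywhere (suc k) f = everywhere k (f true) ∧ everywhere k (f false)

everywhere-sound : ∀ k (f : Booleans k) → T (everywhere k f) → Holds k f
everywhere-sound zero    b holds = holds
everywhere-sound (suc k) f holds true  = everywhere-sound k (f true)  (proj₁ (to T-∧ holds))
everywhere-sound (suc k) f holds false = everywhere-sound k (f false) (proj₂ (to (T-∧ {everywhere k (f true)}) holds))

infixr 4 _⇒ᵇ_
_⇒ᵇ_ : Bool → Bool → Bool
b ⇒ᵇ c = not b ∨ c

⇒ᵇ-elim : ∀ {b c} → T (b ⇒ᵇ c) → T b → T c
⇒ᵇ-elim {true} c _ = c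

atMostOne : Bool → Bool → Bool → Bool → Bool
atMostOne p q r s = not (p ∧ q) ∧ not (p ∧ r) ∧ not (p ∧ s) ∧ not (q ∧ r) ∧ not (q ∧ s) ∧ not (r ∧ s)

module _ {n} (x : Fin n) where

  ≟-exclusive : ∀ {p q} → p ≢ q → T (not (⌊ x ≟ p ⌋ ∧ ⌊ x ≟ q ⌋))
  ≟-exclusive {p} {q} p≢q with x ≟ p | x ≟ q
  ... | yes refl | yes refl = p≢q refl
  ... | yes _    | no  _    = tt
  ... | no  _    | _        = tt

  atMostOne-≟ : ∀ {p q r s} → p ≢ q → p ≢ r → p ≢ s → q ≢ r → q ≢ s → r ≢ s →
    T (atMostOne ⌊ x ≟ p ⌋ ⌊ x ≟ q ⌋ ⌊ x ≟ r ⌋ ⌊ x ≟ s ⌋)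
  atMostOne-≟ p≢q p≢r p≢s q≢r q≢s r≢s = from T-∧ (≟-exclusive p≢q , from T-∧ (≟-exclusive p≢r ,
    from T-∧ (≟-exclusive p≢s , from T-∧ (≟-exclusive q≢r , from T-∧ (≟-exclusive q≢s , ≟-exclusive r≢s)))))

twoPairs : (xp xq xr xs yp yq yr ys : Bool) → Bool
twoPairs xp xq xr xs yp yq yr ys = ((xp ∧ yq) ∨ (xq ∧ yp)) ∨ ((xr ∧ ys) ∨ (xs ∧ yr))

-- Checked by evaluation on all 2⁸ assignments.
χ-twoPairs : ∀ xp xq xr xs yp yq yr ys → T (atMostOne xp xq xr xs) → T (atMostOne yp yq yr ys) →
  χ (twoPairs xp xq xr xs yp yq yr ys) ≡ χ xp * χ yq +ℚ χ xq * χ yp +ℚ (χ xr * χ ys +ℚ χ xs * χ yr)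
χ-twoPairs xp xq xr xs yp yq yr ys x-one y-one =
  toWitness (⇒ᵇ-elim (⇒ᵇ-elim (everywhere-sound 8 identity tt xp xq xr xs yp yq yr ys) x-one) y-one)
  where
  identity : Booleans 8
  identity xp xq xr xs yp yq yr ys = atMostOne xp xq xr xs ⇒ᵇ atMostOne yp yq yr ys ⇒ᵇ
    ⌊ χ (twoPairs xp xq xr xs yp yq yr ys) ≟ℚ χ xp * χ yq +ℚ χ xq * χ yp +ℚ (χ xr * χ ys +ℚ χ xs * χ yr) ⌋

override : Bool → Bool → Bool → Bool
override r s e = if r then false else if s then true else e

χ-override : ∀ r s e → (T r → T e) → (T s → T (not e)) → χ (override r s e) ≡ χ e - χ r +ℚ χ s
χ-override true  false true  _        _        = refl
χ-override true  _     false r⇒e      _        = ⊥-elim (r⇒e tt)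
χ-override true  true  true  _        s⇒¬e     = ⊥-elim (s⇒¬e tt)
χ-override false true  true  _        s⇒¬e     = ⊥-elim (s⇒¬e tt)
χ-override false true  false _        _        = refl
χ-override false false true  _        _        = refl
χ-override false false false _        _        = refl

module _ {n : ℕ} where

  samePair-sym : ∀ (x y p q : Fin n) → samePair x y p q ≡ samePair y x p q
  samePair-sym x y p q = trans (∨-comm (x≟p ∧ y≟q) (x≟q ∧ y≟p)) (cong₂ _∨_ (∧-comm x≟q y≟p) (∧-comm x≟p y≟q))
    where
    x≟p = ⌊ x ≟ p ⌋
    x≟q = ⌊ x ≟ q ⌋
    y≟p = ⌊ y ≟ p ⌋
    y≟q = ⌊ y ≟ q ⌋

  samePair-diag : ∀ (x : Fin n) {p q} → p ≢ q → samePair x x p q ≡ false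
  samePair-diag x {p} {q} p≢q with x ≟ p | x ≟ q
  ... | yes refl | yes refl = contradiction refl p≢q
  ... | yes _    | no  _    = refl
  ... | no  _    | yes _    = refl
  ... | no  _    | no  _    = refl

  samePair⇒≡ : ∀ {x y p q : Fin n} → T (samePair x y p q) → (x ≡ p × y ≡ q) ⊎ (x ≡ q × y ≡ p)
  samePair⇒≡ {x} {y} {p} {q} same = ⊎-map witnesses witnesses (to (T-∨ {⌊ x ≟ p ⌋ ∧ ⌊ y ≟ q ⌋}) same)
    where
    witnesses : ∀ {x y p q : Fin n} → T (⌊ x ≟ p ⌋ ∧ ⌊ y ≟ q ⌋) → x ≡ p × y ≡ q
    witnesses {x} {y} {p} {q} both = let (x≡p , y≡q) = to (T-∧ {⌊ x ≟ p ⌋} {⌊ y ≟ q ⌋}) both in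
      toWitness {a? = x ≟ p} x≡p , toWitness {a? = y ≟ q} y≡q

  χ-samePair-∨ : ∀ (x y : Fin n) {p q r s} → p ≢ q → p ≢ r → p ≢ s → q ≢ r → q ≢ s → r ≢ s →
    χ (samePair x y p q ∨ samePair x y r s) ≡
    χ ⌊ x ≟ p ⌋ * χ ⌊ y ≟ q ⌋ +ℚ χ ⌊ x ≟ q ⌋ * χ ⌊ y ≟ p ⌋ +ℚ (χ ⌊ x ≟ r ⌋ * χ ⌊ y ≟ s ⌋ +ℚ χ ⌊ x ≟ s ⌋ * χ ⌊ y ≟ r ⌋)
  χ-samePair-∨ x y {p} {q} {r} {s} p≢q p≢r p≢s q≢r q≢s r≢s =
    χ-twoPairs ⌊ x ≟ p ⌋ ⌊ x ≟ q ⌋ ⌊ x ≟ r ⌋ ⌊ x ≟ s ⌋ ⌊ y ≟ p ⌋ ⌊ y ≟ q ⌋ ⌊ y ≟ r ⌋ ⌊ y ≟ s ⌋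
      (atMostOne-≟ x p≢q p≢r p≢s q≢r q≢s r≢s) (atMostOne-≟ y p≢q p≢r p≢s q≢r q≢s r≢s)

  adj-samePair : ∀ (G : Graph n) {x y p q} → T (samePair x y p q) → adj G x y ≡ adj G p q
  adj-samePair G {x} {y} {p} {q} same with samePair⇒≡ {x} {y} {p} {q} same
  ... | inj₁ (refl , refl) = refl
  ... | inj₂ (refl , refl) = Graph.sym G _ _

module TwoSwitch {n} {F : Graph n} {a b c d : Fin n} (switch : IsTwoSwitch F a b c d) where

  open IsTwoSwitch switch

  -- switchAdj F a b c d x y unfolds to override (removed x y) (added x y) (adj F x y).
  removed added : Fin n → Fin n → Bool
  removed x y = samePair x y a b ∨ samePair x y c d
  added   x y = samePair x y a c ∨ samePair x y b d

  removed⇒edge : ∀ {x y} → T (removed x y) → T (adj F x y)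
  removed⇒edge {x} {y} r = from T-≡
    ([ (λ same → trans (adj-samePair F same) ab∈E) , (λ same → trans (adj-samePair F same) cd∈E) ]′
      (to (T-∨ {samePair x y a b}) r))

  added⇒non-edge : ∀ {x y} → T (added x y) → T (not (adj F x y))
  added⇒non-edge {x} {y} s = from T-not-≡
    ([ (λ same → trans (adj-samePair F same) ac∉E) , (λ same → trans (adj-samePair F same) bd∉E) ]′
      (to (T-∨ {samePair x y a c}) s))

  switchGraph : Graph n
  switchGraph = record { adj = switchAdj F a b c d ; sym = switch-sym ; irrefl = switch-irrefl }
    where
    switch-sym : ∀ x y →
      override (removed x y) (added x y) (adj F x y) ≡ override (removed y x) (added y x) (adj F y x)
    switch-sym x y = begin
      override (removed x y) (added x y) (adj F x y)
        ≡⟨ cong₂ (λ r s → override r s (adj F x y))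
                 (cong₂ _∨_ (samePair-sym x y a b) (samePair-sym x y c d))
                 (cong₂ _∨_ (samePair-sym x y a c) (samePair-sym x y b d)) ⟩
      override (removed y x) (added y x) (adj F x y)
        ≡⟨ cong (override (removed y x) (added y x)) (Graph.sym F x y) ⟩
      override (removed y x) (added y x) (adj F y x) ∎
    switch-irrefl : ∀ x → override (removed x x) (added x x) (adj F x x) ≡ false
    switch-irrefl x = begin
      override (removed x x) (added x x) (adj F x x)
        ≡⟨ cong₂ (λ r s → override r s (adj F x x))
                 (cong₂ _∨_ (samePair-diag x a≢b) (samePair-diag x c≢d))
                 (cong₂ _∨_ (samePair-diag x a≢c) (samePair-diag x b≢d)) ⟩
      adj F x x
        ≡⟨ Graph.irrefl F x ⟩
      false ∎

  δ : Fin n → Fin n → ℚ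
  δ x p = χ ⌊ x ≟ p ⌋

  switch-update : ∀ x y → adjMatrix (switchAdj F a b c d) x y ≡
    adjMatrix (adj F) x y +ℚ (δ y a - δ y d) * (δ x c - δ x b) +ℚ (δ y c - δ y b) * (δ x a - δ x d)
  switch-update x y = begin
    χ (override (removed x y) (added x y) (adj F x y))
      ≡⟨ χ-override (removed x y) (added x y) (adj F x y) removed⇒edge added⇒non-edge ⟩
    χ (adj F x y) - χ (removed x y) +ℚ χ (added x y)
      ≡⟨ cong₂ (λ r s → χ (adj F x y) - r +ℚ s)
           (χ-samePair-∨ x y a≢b a≢c a≢d b≢c b≢d c≢d) (χ-samePair-∨ x y a≢c a≢b a≢d (b≢c ∘ sym) c≢d b≢d) ⟩
    χ (adj F x y) - (δ x a * δ y b +ℚ δ x b * δ y a +ℚ (δ x c * δ y d +ℚ δ x d * δ y c))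
                  +ℚ (δ x a * δ y c +ℚ δ x c * δ y a +ℚ (δ x b * δ y d +ℚ δ x d * δ y b))
      ≡⟨ solve 9 (λ e xa xb xc xd ya yb yc yd →
             e :- (xa :* yb :+ xb :* ya :+ (xc :* yd :+ xd :* yc)) :+ (xa :* yc :+ xc :* ya :+ (xb :* yd :+ xd :* yb))
          := e :+ (ya :- yd) :* (xc :- xb) :+ (yc :- yb) :* (xa :- xd))
          refl (χ (adj F x y)) (δ x a) (δ x b) (δ x c) (δ x d) (δ y a) (δ y b) (δ y c) (δ y d) ⟩
    χ (adj F x y) +ℚ (δ y a - δ y d) * (δ x c - δ x b) +ℚ (δ y c - δ y b) * (δ x a - δ x d) ∎

  rank-switch-∣-∣≤2 : ∀ {r r′} → IsRank (adjMatrix (adj F)) r → IsRank (adjMatrix (switchAdj F a b c d)) r′ →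
    ∣ r′ - r ∣ ≤ 2
  rank-switch-∣-∣≤2 = rank-two-update⇒∣-∣≤2 {M = adjMatrix (adj F)} {adjMatrix (switchAdj F a b c d)}
    (λ x → δ x c - δ x b) (λ y → δ y a - δ y d) (λ x → δ x a - δ x d) (λ y → δ y c - δ y b) switch-update

∣m-n∣≡∣o∸m-o∸n∣ : ∀ {m n o} → m ≤ o → n ≤ o → ∣ m - n ∣ ≡ ∣ o ∸ m - o ∸ n ∣
∣m-n∣≡∣o∸m-o∸n∣ {zero}  {n}     {o}     _         n≤o       =
  sym (trans (m≤n⇒∣n-m∣≡n∸m (m∸n≤m o n)) (m∸[m∸n]≡n n≤o))
∣m-n∣≡∣o∸m-o∸n∣ {suc m} {zero}  {o}     m≤o       _         =
  sym (trans (m≤n⇒∣m-n∣≡n∸m (m∸n≤m o (suc m))) (m∸[m∸n]≡n m≤o))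
∣m-n∣≡∣o∸m-o∸n∣ {suc m} {suc n} {suc o} (s≤s m≤o) (s≤s n≤o) = ∣m-n∣≡∣o∸m-o∸n∣ m≤o n≤o

even∧∣m-n∣≤2⇒0∨2 : ∀ {m n} → 2 ∣ m → 2 ∣ n → ∣ m - n ∣ ≤ 2 → ∣ m - n ∣ ≡ 0 ⊎ ∣ m - n ∣ ≡ 2
even∧∣m-n∣≤2⇒0∨2 (divides-refl h) (divides-refl h′) d≤2 =
  subst Zero-or-two (*-distribʳ-∣-∣ 2 h h′) (halves ∣ h - h′ ∣ (subst (_≤ 2) (sym (*-distribʳ-∣-∣ 2 h h′)) d≤2))
  where
  Zero-or-two : ℕ → Set
  Zero-or-two d = d ≡ 0 ⊎ d ≡ 2
  halves : ∀ e → e ℕ.* 2 ≤ 2 → Zero-or-two (e ℕ.* 2)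
  halves 0 _ = inj₁ refl
  halves 1 _ = inj₂ refl
  halves (suc (suc e)) (s≤s (s≤s ()))

mainTheorem19 : (n : ℕ) (F : Graph n) (a b c d : Fin n) →
    IsTwoSwitch F a b c d →
    IsForest (adj F) → IsForest (switchAdj F a b c d) →
    (r r′ : ℕ) → IsRank (adjMatrix (adj F)) r →
    IsRank (adjMatrix (switchAdj F a b c d)) r′ →
    (∣ r′ - r ∣ ≡ ∣ nullity n r′ - nullity n r ∣) ×
    (∣ r′ - r ∣ ≡ 0 ⊎ ∣ r′ - r ∣ ≡ 2)
mainTheorem19 n F a b c d switch forest forest′ r r′ rank rank′ =
    ∣m-n∣≡∣o∸m-o∸n∣ (rank≤n (adjMatrix (switchAdj F a b c d)) rank′) (rank≤n (adjMatrix (adj F)) rank)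
  , even∧∣m-n∣≤2⇒0∨2 (forest-rank-even switchGraph forest′ rank′) (forest-rank-even F forest rank)
      (rank-switch-∣-∣≤2 rank rank′)
  where open TwoSwitch switch
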